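{- Let $\mathbf{Q}$ be a non-flat QB-algebra (i.e. $1\neq0$) and $x$ a regular element of $\mathbf{Q}$. Then $cl(x)\cap cl(x^{*})=\emptyset$.
   Context: A quasi-lattice is an algebra $\langle L;\vee,\wedge\rangle$ such that for all $x,y,z$: $\vee,\wedge$ are commutative and associative; $x\vee(x\wedge y)=x\vee x$ and $x\wedge(x\vee y)=x\wedge x$; $x\vee(y\vee y)=x\vee y$ and $x\wedge(y\wedge y)=x\wedge y$; $x\vee x=x\wedge x$; distributive if both distributive laws hold. A QB-algebra is an algebra $\langle Q;\vee,\wedge,{}^{*},0,1\rangle$ of type $\langle 2,2,1,0,0\rangle$ such that $\langle Q;\vee,\wedge\rangle$ is a distributive quasi-lattice and for all $x$: $x\vee 1=1$, $x\wedge 0=0$, $x\vee x^{*}=1$, $x\wedge x^{*}=0$, $(x\wedge x)^{*}=x^{*}\vee x^{*}$, $x^{**}=x$. A QB-algebra is flat if $1=0$. An element $x$ is regular if $x\vee x=x$. For a regular element $x$, $cl(x)=\{y\in Q: y\vee y=x\vee x\}$ (the cloud of $x$). -}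

module Defs where

open import Level using (Level; suc)
open import Relation.Binary.PropositionalEquality using (_≡_)
open import Relation.Nullary using (¬_)
open import Data.Product using (_×_)

record QBAlgebra (ℓ : Level) : Set (suc ℓ) where
  infixr 6 _∨_
  infixr 7 _∧_
  field
    Q    : Set ℓ
    _∨_  : Q → Q → Q
    _∧_  : Q → Q → Q
    _*   : Q → Q
    𝟎    : Q
    𝟏    : Q
    ∨-comm  : ∀ x y → x ∨ y ≡ y ∨ x
    ∧-comm  : ∀ x y → x ∧ y ≡ y ∧ x
    ∨-assoc : ∀ x y z → (x ∨ y) ∨ z ≡ x ∨ (y ∨ z)
    ∧-assoc : ∀ x y z → (x ∧ y) ∧ z ≡ x ∧ (y ∧ z)
    ∨-absorb : ∀ x y → x ∨ (x ∧ y) ≡ x ∨ x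
    ∧-absorb : ∀ x y → x ∧ (x ∨ y) ≡ x ∧ x
    ∨-idem-r : ∀ x y → x ∨ (y ∨ y) ≡ x ∨ y
    ∧-idem-r : ∀ x y → x ∧ (y ∧ y) ≡ x ∧ y
    ∨∧-same  : ∀ x → x ∨ x ≡ x ∧ x
    ∧-distrib-∨ : ∀ x y z → x ∧ (y ∨ z) ≡ (x ∧ y) ∨ (x ∧ z)
    ∨-distrib-∧ : ∀ x y z → x ∨ (y ∧ z) ≡ (x ∨ y) ∧ (x ∨ z)
    ∨-one   : ∀ x → x ∨ 𝟏 ≡ 𝟏
    ∧-zero  : ∀ x → x ∧ 𝟎 ≡ 𝟎
    ∨-compl : ∀ x → x ∨ (x *) ≡ 𝟏
    ∧-compl : ∀ x → x ∧ (x *) ≡ 𝟎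
    *-∧     : ∀ x → (x ∧ x) * ≡ (x *) ∨ (x *)
    *-invol : ∀ x → (x *) * ≡ x

  Flat : Set ℓ
  Flat = 𝟏 ≡ 𝟎

  Regular : Q → Set ℓ
  Regular x = x ∨ x ≡ x

  _∈cl_ : Q → Q → Set ℓ
  y ∈cl x = y ∨ y ≡ x ∨ x

-- If y lies in both clouds then x = y ∨ y = x* ∨ x* = x* ∧ x*.  An element
-- of the form z ∨ z absorbs z under ∨, and one of the form z ∧ z absorbs z
-- under ∧; applied with z = x* this gives 1 = x ∨ x* = x and 0 = x ∧ x* = x.
module Submission where

open import Defs
open import Level using (Level)
open import Relation.Nullary using (¬_)
open import Data.Product using (_×_; _,_)
open import Relation.Binary.PropositionalEquality using (_≡_; sym; trans; cong; module ≡-Reasoning)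

module QBAlgebraProperties {ℓ : Level} (A : QBAlgebra ℓ) where
  open QBAlgebra A
  open ≡-Reasoning

  ∨-square-absorbs : ∀ z → (z ∨ z) ∨ z ≡ z ∨ z
  ∨-square-absorbs z = begin
    (z ∨ z) ∨ z ≡⟨ ∨-comm (z ∨ z) z ⟩
    z ∨ (z ∨ z) ≡⟨ ∨-idem-r z z ⟩
    z ∨ z       ∎

  ∧-square-absorbs : ∀ z → (z ∧ z) ∧ z ≡ z ∧ z
  ∧-square-absorbs z = begin
    (z ∧ z) ∧ z ≡⟨ ∧-comm (z ∧ z) z ⟩
    z ∧ (z ∧ z) ≡⟨ ∧-idem-r z z ⟩
    z ∧ z       ∎

  ≡*∨*⇒≡𝟏 : ∀ x → x ≡ (x *) ∨ (x *) → 𝟏 ≡ x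
  ≡*∨*⇒≡𝟏 x x≡ = begin
    𝟏                       ≡⟨ sym (∨-compl x) ⟩
    x ∨ (x *)               ≡⟨ cong (_∨ (x *)) x≡ ⟩
    ((x *) ∨ (x *)) ∨ (x *) ≡⟨ ∨-square-absorbs (x *) ⟩
    (x *) ∨ (x *)           ≡⟨ sym x≡ ⟩
    x                       ∎

  ≡*∧*⇒≡𝟎 : ∀ x → x ≡ (x *) ∧ (x *) → 𝟎 ≡ x
  ≡*∧*⇒≡𝟎 x x≡ = begin
    𝟎                       ≡⟨ sym (∧-compl x) ⟩
    x ∧ (x *)               ≡⟨ cong (_∧ (x *)) x≡ ⟩
    ((x *) ∧ (x *)) ∧ (x *) ≡⟨ ∧-square-absorbs (x *) ⟩
    (x *) ∧ (x *)           ≡⟨ sym x≡ ⟩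
    x                       ∎

  ∈cl-both⇒≡*∨* : ∀ x → Regular x → ∀ y → y ∈cl x → y ∈cl (x *) → x ≡ (x *) ∨ (x *)
  ∈cl-both⇒≡*∨* x reg y y∈clx y∈clx* = begin
    x             ≡⟨ sym reg ⟩
    x ∨ x         ≡⟨ sym y∈clx ⟩
    y ∨ y         ≡⟨ y∈clx* ⟩
    (x *) ∨ (x *) ∎

  ≡*∨*⇒Flat : ∀ x → x ≡ (x *) ∨ (x *) → Flat
  ≡*∨*⇒Flat x x≡ =
    trans (≡*∨*⇒≡𝟏 x x≡) (sym (≡*∧*⇒≡𝟎 x (trans x≡ (∨∧-same (x *)))))

corollary3p7 : ∀ {ℓ : Level} (A : QBAlgebra ℓ) → let open QBAlgebra A in
    ¬ Flat → (x : Q) → Regular x → (y : Q) → ¬ ((y ∈cl x) × (y ∈cl (x *)))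
corollary3p7 A nonFlat x reg y (y∈clx , y∈clx*) =
  nonFlat (≡*∨*⇒Flat x (∈cl-both⇒≡*∨* x reg y y∈clx y∈clx*))
  where open QBAlgebraProperties A
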